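{- Let $G$ be a graph with $n$ vertices. Then $$\sum_{S \in \mathcal{D}(G)} |a(S)| = 2D'(G,1) - nD(G,1).$$
   Context: Graphs are finite and simple. A set $S \subseteq V(G)$ is a dominating set if every vertex is in $S$ or adjacent to a vertex of $S$; $\mathcal{D}(G)$ is the collection of dominating sets. The domination polynomial is $D(G,x) = \sum_{k} d_k(G) x^k$, where $d_k(G)$ is the number of dominating sets of $G$ of cardinality $k$, and $D'(G,x)$ is its derivative. For $S \in \mathcal{D}(G)$, $a(S) = \{v \in S : S - \{v\} \notin \mathcal{D}(G)\}$. -}

module Defs where

open import Data.Bool using (Bool; T)
open import Data.Nat using (ℕ; zero; suc; _*_; _+_)
open import Data.Integer using (ℤ)
open import Data.Fin using (Fin)
open import Data.Fin.Subset using (Subset; _∈_; _∉_; _-_; ∣_∣; inside; outside)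
open import Data.Fin.Subset.Properties using (_∈?_)
open import Data.Fin.Properties using (all?; any?; _≟_)
open import Data.Vec using ([]; _∷_)
open import Data.List using (List; []; _∷_; [_]; map; _++_; length; filter; upTo; allFin)
open import Data.Nat.ListAction using (sum)
open import Data.Nat using () renaming (_≟_ to _≟ℕ_)
open import Data.Product using (Σ; ∃; _×_; _,_)
open import Data.Sum using (_⊎_)
open import Relation.Nullary using (Dec; ¬_; ¬?)
open import Relation.Nullary.Decidable using (_×-dec_; _⊎-dec_)
open import Relation.Binary.PropositionalEquality using (_≡_)

record Graph (n : ℕ) : Set where
  field
    adj   : Fin n → Fin n → Bool
    sym   : ∀ u v → adj u v ≡ adj v u
    irrefl : ∀ v → adj v v ≡ Data.Bool.false

open Graph public

Adj : ∀ {n} → Graph n → Fin n → Fin n → Set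
Adj G u v = T (adj G u v)

Dominating : ∀ {n} → Graph n → Subset n → Set
Dominating G S = ∀ v → v ∈ S ⊎ ∃ λ u → u ∈ S × Adj G u v

dominating? : ∀ {n} (G : Graph n) (S : Subset n) → Dec (Dominating G S)
dominating? G S = all? λ v → (v ∈? S) ⊎-dec any? (λ u → (u ∈? S) ×-dec Data.Bool.T? (adj G u v))

allSubsets : (n : ℕ) → List (Subset n)
allSubsets zero = [ [] ]
allSubsets (suc n) = map (outside ∷_) (allSubsets n) ++ map (inside ∷_) (allSubsets n)

domSets : ∀ {n} → Graph n → List (Subset n)
domSets {n} G = filter (dominating? G) (allSubsets n)

aSet : ∀ {n} → Graph n → Subset n → List (Fin n)
aSet {n} G S = filter (λ v → (v ∈? S) ×-dec ¬? (dominating? G (S - v))) (allFin n)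

d : ∀ {n} → Graph n → ℕ → ℕ
d G k = length (filter (λ S → ∣ S ∣ ≟ℕ k) (domSets G))

-- D(G,1) = Σ_{k=0}^{n} d_k(G)   (d_k = 0 for k > n)
D-at-1 : ∀ {n} → Graph n → ℕ
D-at-1 {n} G = sum (map (d G) (upTo (suc n)))

D'-at-1 : ∀ {n} → Graph n → ℕ
D'-at-1 {n} G = sum (map (λ k → k * d G k) (upTo (suc n)))

sumA : ∀ {n} → Graph n → ℕ
sumA G = sum (map (λ S → length (aSet G S)) (domSets G))

module Submission where

-- Σ_{S ∈ 𝒟(G)} |a(S)| = 2 D'(G,1) − n D(G,1), by double counting the pairs (S , v) with
-- S a dominating set and v ∈ S.  For a vertex v let
--   containing v = #{S ∈ 𝒟 : v ∈ S},  avoiding v = #{S ∈ 𝒟 : v ∉ S},  critical v = #{S ∈ 𝒟 : v ∈ a(S)}.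
-- (1) If v ∈ S ∈ 𝒟 then either v ∈ a(S) or S − v is dominating, and toggling v is a bijection
--     from the sets of the second kind onto the dominating sets avoiding v:
--     containing v = critical v + avoiding v.
-- (2) Every dominating set contains or avoids v: containing v + avoiding v = |𝒟|.
-- Hence critical v + |𝒟| = 2 · containing v, and summing over the n vertices gives
--   Σ_{S∈𝒟} |a(S)| + n |𝒟| = 2 Σ_{S∈𝒟} |S|,
-- while grouping the dominating sets by size identifies D(G,1) = |𝒟| and D'(G,1) = Σ_{S∈𝒟} |S|.

open import Defs hiding (sym)
open import Relation.Binary.PropositionalEquality using (_≡_; refl; sym; trans; cong; cong₂; module ≡-Reasoning)
open import Function using (_∘_; id; const)

module Counting where

  open import Data.Bool using (true; false; not; if_then_else_)
  open import Data.Fin using (Fin; zero; suc)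
  open import Data.Fin.Subset using (Subset; _∈_; _-_; ⁅_⁆; ∣_∣; inside; outside; _⊆_)
  open import Data.Fin.Subset.Properties using (_∈?_; ∣p∣≤n; p─q⊆p; p─⊥≡p)
  open import Data.Vec using ([]; _∷_; here; there; _[_]%=_)
  open import Data.List using (List; []; _∷_; map; _++_; length; filter; upTo; applyUpTo; allFin)
  open import Data.List.Properties using (map-++; map-cong; map-∘; map-tabulate; map-upTo; length-tabulate)
  open import Data.Nat.ListAction using (sum)
  open import Data.Nat.ListAction.Properties using (sum-++)
  open import Data.Product using (_,_)
  open import Data.Sum using (inj₁; inj₂)
  open import Relation.Nullary using (Dec; yes; no; does; ¬?; contradiction)
  open import Relation.Nullary.Decidable using (_×-dec_)
  open import Data.Nat using (ℕ; zero; suc; _+_; _*_; _<_; s≤s; _≟_)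
  open import Data.Nat.Properties
    using (+-comm; +-identityʳ; *-identityˡ; *-identityʳ; *-zeroʳ; *-comm; *-distribˡ-+)
  open import Data.Nat.Tactic.RingSolver using (solve-∀)
  open import Level using (Level)
  open ≡-Reasoning

  private variable
    a b : Level
    A : Set a
    B : Set b

  𝟙 : ∀ {p} {P : Set p} → Dec P → ℕ
  𝟙 P? = if does P? then 1 else 0

  ∑ : List A → (A → ℕ) → ℕ
  ∑ xs f = sum (map f xs)

  syntax ∑ xs (λ x → e) = ∑[ x ∈ xs ] e

  ∑-cong : ∀ (xs : List A) {f g : A → ℕ} → (∀ x → f x ≡ g x) → ∑ xs f ≡ ∑ xs g
  ∑-cong xs f≗g = cong sum (map-cong f≗g xs)

  ∑-++ : ∀ (xs ys : List A) f → ∑ (xs ++ ys) f ≡ ∑ xs f + ∑ ys f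
  ∑-++ xs ys f = trans (cong sum (map-++ f xs ys)) (sum-++ (map f xs) (map f ys))

  ∑-map : ∀ (h : B → A) (xs : List B) f → ∑ (map h xs) f ≡ ∑ xs (f ∘ h)
  ∑-map h xs f = cong sum (sym (map-∘ xs))

  ∑-const : ∀ (xs : List A) c → ∑[ _ ∈ xs ] c ≡ length xs * c
  ∑-const []       c = refl
  ∑-const (x ∷ xs) c = cong (c +_) (∑-const xs c)

  ∑-+ : ∀ (xs : List A) f g → ∑[ x ∈ xs ] (f x + g x) ≡ ∑ xs f + ∑ xs g
  ∑-+ []       f g = refl
  ∑-+ (x ∷ xs) f g = trans (cong (f x + g x +_) (∑-+ xs f g)) (interchange (f x) (g x) _ _)
    where
    interchange : ∀ a b c d → (a + b) + (c + d) ≡ (a + c) + (b + d)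
    interchange = solve-∀

  ∑-*ˡ : ∀ (xs : List A) c f → ∑[ x ∈ xs ] (c * f x) ≡ c * ∑ xs f
  ∑-*ˡ []       c f = sym (*-zeroʳ c)
  ∑-*ˡ (x ∷ xs) c f = trans (cong (c * f x +_) (∑-*ˡ xs c f)) (sym (*-distribˡ-+ c (f x) _))

  ∑-swap : ∀ (xs : List A) (ys : List B) (F : A → B → ℕ) →
    ∑[ x ∈ xs ] ∑[ y ∈ ys ] F x y ≡ ∑[ y ∈ ys ] ∑[ x ∈ xs ] F x y
  ∑-swap []       ys F = sym (trans (∑-const ys 0) (*-zeroʳ (length ys)))
  ∑-swap (x ∷ xs) ys F =
    trans (cong (∑ ys (F x) +_) (∑-swap xs ys F)) (sym (∑-+ ys (F x) (λ y → ∑[ x′ ∈ xs ] F x′ y)))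

  length-filter : ∀ {p} {P : A → Set p} (P? : ∀ x → Dec (P x)) (xs : List A) →
    length (filter P? xs) ≡ ∑[ x ∈ xs ] 𝟙 (P? x)
  length-filter P? [] = refl
  length-filter P? (x ∷ xs) with does (P? x)
  ... | true  = cong suc (length-filter P? xs)
  ... | false = length-filter P? xs

  ∑-filter : ∀ {p} {P : A → Set p} (P? : ∀ x → Dec (P x)) (xs : List A) f →
    ∑ (filter P? xs) f ≡ ∑[ x ∈ xs ] (𝟙 (P? x) * f x)
  ∑-filter P? [] f = refl
  ∑-filter P? (x ∷ xs) f with does (P? x)
  ... | true  = cong₂ _+_ (sym (+-identityʳ (f x))) (∑-filter P? xs f)
  ... | false = ∑-filter P? xs f

  sift : ∀ L m (g : ℕ → ℕ) → m < L → ∑[ k ∈ upTo L ] (𝟙 (m ≟ k) * g k) ≡ g m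
  sift L m g m<L = trans (cong sum (map-upTo _ L)) (sift-applyUpTo L m g m<L)
    where
    zeros : ∀ L → sum (applyUpTo (λ _ → 0) L) ≡ 0
    zeros zero    = refl
    zeros (suc L) = zeros L

    sift-applyUpTo : ∀ L m (g : ℕ → ℕ) → m < L → sum (applyUpTo (λ k → 𝟙 (m ≟ k) * g k) L) ≡ g m
    sift-applyUpTo (suc L) zero    g _         =
      trans (cong (g 0 + 0 +_) (zeros L)) (trans (+-identityʳ _) (+-identityʳ _))
    sift-applyUpTo (suc L) (suc m) g (s≤s m<L) = sift-applyUpTo L m (g ∘ suc) m<L

  ∑-by-size : ∀ (s : A → ℕ) L → (∀ x → s x < L) → (g : ℕ → ℕ) (xs : List A) →
    ∑[ k ∈ upTo L ] (g k * length (filter (λ x → s x ≟ k) xs)) ≡ ∑[ x ∈ xs ] g (s x)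
  ∑-by-size s L bounded g xs = begin
    ∑[ k ∈ upTo L ] (g k * length (filter (λ x → s x ≟ k) xs))
      ≡⟨ ∑-cong (upTo L) (λ k → cong (g k *_) (length-filter (λ x → s x ≟ k) xs)) ⟩
    ∑[ k ∈ upTo L ] (g k * ∑[ x ∈ xs ] 𝟙 (s x ≟ k))
      ≡⟨ ∑-cong (upTo L) (λ k → sym (∑-*ˡ xs (g k) (λ x → 𝟙 (s x ≟ k)))) ⟩
    ∑[ k ∈ upTo L ] ∑[ x ∈ xs ] (g k * 𝟙 (s x ≟ k))
      ≡⟨ ∑-swap (upTo L) xs _ ⟩
    ∑[ x ∈ xs ] ∑[ k ∈ upTo L ] (g k * 𝟙 (s x ≟ k))
      ≡⟨ ∑-cong xs (λ x → trans (∑-cong (upTo L) (λ k → *-comm (g k) _)) (sift L (s x) g (bounded x))) ⟩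
    ∑[ x ∈ xs ] g (s x) ∎

  ∑-allFin-suc : ∀ n f → ∑ (allFin (suc n)) f ≡ f zero + ∑ (allFin n) (f ∘ suc)
  ∑-allFin-suc n f = cong (λ l → f zero + sum l) (trans (map-tabulate suc f) (sym (map-tabulate id (f ∘ suc))))

  ∣∣-as-∑ : ∀ {n} (S : Subset n) → ∣ S ∣ ≡ ∑[ v ∈ allFin n ] 𝟙 (v ∈? S)
  ∣∣-as-∑ []          = refl
  ∣∣-as-∑ (true ∷ S)  = trans (cong suc (∣∣-as-∑ S)) (sym (∑-allFin-suc _ (λ v → 𝟙 (v ∈? (true ∷ S)))))
  ∣∣-as-∑ (false ∷ S) = trans (∣∣-as-∑ S) (sym (∑-allFin-suc _ (λ v → 𝟙 (v ∈? (false ∷ S)))))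

  ∑-allSubsets-suc : ∀ n f →
    ∑ (allSubsets (suc n)) f ≡ ∑ (allSubsets n) (f ∘ (outside ∷_)) + ∑ (allSubsets n) (f ∘ (inside ∷_))
  ∑-allSubsets-suc n f =
    trans (∑-++ (map (outside ∷_) subsets) _ f)
          (cong₂ _+_ (∑-map (outside ∷_) subsets f) (∑-map (inside ∷_) subsets f))
    where
    subsets : List (Subset n)
    subsets = allSubsets n

  toggle : ∀ {n} → Fin n → Subset n → Subset n
  toggle v S = S [ v ]%= not

  -- Toggling a vertex is a bijection of the subsets, so it does not change a sum over all of them.
  ∑-toggle : ∀ {n} (v : Fin n) f → ∑ (allSubsets n) f ≡ ∑ (allSubsets n) (f ∘ toggle v)
  ∑-toggle {suc n} zero f = begin
    ∑ (allSubsets (suc n)) f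
      ≡⟨ ∑-allSubsets-suc n f ⟩
    ∑ subsets (f ∘ (outside ∷_)) + ∑ subsets (f ∘ (inside ∷_))
      ≡⟨ +-comm (∑ subsets (f ∘ (outside ∷_))) _ ⟩
    ∑ subsets (f ∘ (inside ∷_)) + ∑ subsets (f ∘ (outside ∷_))
      ≡⟨ sym (∑-allSubsets-suc n (f ∘ toggle zero)) ⟩
    ∑ (allSubsets (suc n)) (f ∘ toggle zero) ∎
    where
    subsets : List (Subset n)
    subsets = allSubsets n
  ∑-toggle {suc n} (suc v) f = begin
    ∑ (allSubsets (suc n)) f
      ≡⟨ ∑-allSubsets-suc n f ⟩
    ∑ subsets (f ∘ (outside ∷_)) + ∑ subsets (f ∘ (inside ∷_))
      ≡⟨ cong₂ _+_ (∑-toggle v _) (∑-toggle v _) ⟩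
    ∑ subsets (f ∘ (outside ∷_) ∘ toggle v) + ∑ subsets (f ∘ (inside ∷_) ∘ toggle v)
      ≡⟨ sym (∑-allSubsets-suc n (f ∘ toggle (suc v))) ⟩
    ∑ (allSubsets (suc n)) (f ∘ toggle (suc v)) ∎
    where
    subsets : List (Subset n)
    subsets = allSubsets n

  toggle-∉ : ∀ {n} (v : Fin n) S → 𝟙 (¬? (v ∈? toggle v S)) ≡ 𝟙 (v ∈? S)
  toggle-∉ zero    (true ∷ S)  = refl
  toggle-∉ zero    (false ∷ S) = refl
  toggle-∉ (suc v) (b ∷ S)     = toggle-∉ v S

  remove-is-toggle : ∀ {n} (v : Fin n) S → v ∈ S → S - v ≡ toggle v S
  remove-is-toggle zero    (true ∷ S) here    = cong (false ∷_) (p─⊥≡p S)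
  remove-is-toggle (suc v) (b ∷ S)   (there p) = cong (b ∷_) (remove-is-toggle v S p)

  removal-by-toggle : ∀ {n} (v : Fin n) S (f : Subset n → ℕ) →
    𝟙 (¬? (v ∈? toggle v S)) * f (toggle v S) ≡ 𝟙 (v ∈? S) * f (S - v)
  removal-by-toggle v S f rewrite toggle-∉ v S with v ∈? S
  ... | yes v∈S = cong (λ T → 1 * f T) (sym (remove-is-toggle v S v∈S))
  ... | no  _   = refl

  𝟙-split : ∀ {P Q R : Set} (P? : Dec P) (Q? : Dec Q) (R? : Dec R) → (R → Q) →
    𝟙 Q? * 𝟙 (P? ×-dec ¬? R?) + 𝟙 P? * 𝟙 R? ≡ 𝟙 Q? * 𝟙 P?
  𝟙-split (yes _) (yes _) (yes _) _   = refl
  𝟙-split (yes _) (yes _) (no _)  _   = refl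
  𝟙-split (yes _) (no ¬q) (yes r) R⇒Q = contradiction (R⇒Q r) ¬q
  𝟙-split (yes _) (no _)  (no _)  _   = refl
  𝟙-split (no _)  (yes _) _       _   = refl
  𝟙-split (no _)  (no _)  _       _   = refl

  𝟙-complement : ∀ {P : Set} (P? : Dec P) x → x * 𝟙 P? + 𝟙 (¬? P?) * x ≡ x
  𝟙-complement (yes _) x = trans (+-identityʳ (x * 1)) (*-identityʳ x)
  𝟙-complement (no _)  x = cong₂ _+_ (*-zeroʳ x) (+-identityʳ x)

  double-count : ∀ {a b c N} → c ≡ a + b → c + b ≡ N → a + N ≡ 2 * c
  double-count {a} {b} refl refl = identity a b
    where
    identity : ∀ a b → a + ((a + b) + b) ≡ 2 * (a + b)
    identity = solve-∀

  dominating-mono : ∀ {n} (G : Graph n) {S T} → S ⊆ T → Dominating G S → Dominating G T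
  dominating-mono G S⊆T dom v with dom v
  ... | inj₁ v∈S              = inj₁ (S⊆T v∈S)
  ... | inj₂ (u , u∈S , u~v)  = inj₂ (u , S⊆T u∈S , u~v)

  module _ {n : ℕ} (G : Graph n) where

    dom : Subset n → ℕ
    dom S = 𝟙 (dominating? G S)

    #dominating : ℕ
    #dominating = ∑[ S ∈ allSubsets n ] dom S

    containing avoiding critical : Fin n → ℕ
    containing v = ∑[ S ∈ allSubsets n ] (dom S * 𝟙 (v ∈? S))
    avoiding   v = ∑[ S ∈ allSubsets n ] (𝟙 (¬? (v ∈? S)) * dom S)
    critical   v = ∑[ S ∈ allSubsets n ] (dom S * 𝟙 ((v ∈? S) ×-dec ¬? (dominating? G (S - v))))

    -- (1) A dominating set containing v either has v critical, or loses v to a dominating set avoiding v.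
    containing≡critical+avoiding : ∀ v → containing v ≡ critical v + avoiding v
    containing≡critical+avoiding v = begin
      containing v
        ≡⟨ ∑-cong (allSubsets n) (λ S → sym (𝟙-split (v ∈? S) (dominating? G S) (dominating? G (S - v))
                                                   (dominating-mono G (p─q⊆p S ⁅ v ⁆)))) ⟩
      ∑[ S ∈ allSubsets n ] (dom S * 𝟙 ((v ∈? S) ×-dec ¬? (dominating? G (S - v))) + 𝟙 (v ∈? S) * dom (S - v))
        ≡⟨ ∑-+ (allSubsets n) _ _ ⟩
      critical v + ∑[ S ∈ allSubsets n ] (𝟙 (v ∈? S) * dom (S - v))
        ≡⟨ cong (critical v +_) (∑-cong (allSubsets n) (λ S → sym (removal-by-toggle v S dom))) ⟩
      critical v + ∑[ S ∈ allSubsets n ] (𝟙 (¬? (v ∈? toggle v S)) * dom (toggle v S))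
        ≡⟨ cong (critical v +_) (sym (∑-toggle v (λ S → 𝟙 (¬? (v ∈? S)) * dom S))) ⟩
      critical v + avoiding v ∎

    containing+avoiding : ∀ v → containing v + avoiding v ≡ #dominating
    containing+avoiding v =
      trans (sym (∑-+ (allSubsets n) _ _)) (∑-cong (allSubsets n) (λ S → 𝟙-complement (v ∈? S) (dom S)))

    double-counting : ∑ (allFin n) critical + n * #dominating ≡ 2 * ∑ (allFin n) containing
    double-counting = begin
      ∑ (allFin n) critical + n * #dominating
        ≡⟨ cong (∑ (allFin n) critical +_) (sym (trans (∑-const (allFin n) #dominating)
                                                        (cong (_* #dominating) (length-tabulate {n = n} id)))) ⟩
      ∑ (allFin n) critical + ∑[ _ ∈ allFin n ] #dominating
        ≡⟨ sym (∑-+ (allFin n) critical _) ⟩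
      ∑[ v ∈ allFin n ] (critical v + #dominating)
        ≡⟨ ∑-cong (allFin n) (λ v → double-count (containing≡critical+avoiding v) (containing+avoiding v)) ⟩
      ∑[ v ∈ allFin n ] (2 * containing v)
        ≡⟨ ∑-*ˡ (allFin n) 2 containing ⟩
      2 * ∑ (allFin n) containing ∎

    ∑-dominating : (w : Subset n → Fin n → ℕ) →
      ∑[ S ∈ domSets G ] ∑[ v ∈ allFin n ] w S v ≡ ∑[ v ∈ allFin n ] ∑[ S ∈ allSubsets n ] (dom S * w S v)
    ∑-dominating w = begin
      ∑[ S ∈ domSets G ] ∑[ v ∈ allFin n ] w S v
        ≡⟨ ∑-filter (dominating? G) (allSubsets n) _ ⟩
      ∑[ S ∈ allSubsets n ] (dom S * ∑[ v ∈ allFin n ] w S v)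
        ≡⟨ ∑-cong (allSubsets n) (λ S → sym (∑-*ˡ (allFin n) (dom S) (w S))) ⟩
      ∑[ S ∈ allSubsets n ] ∑[ v ∈ allFin n ] (dom S * w S v)
        ≡⟨ ∑-swap (allSubsets n) (allFin n) _ ⟩
      ∑[ v ∈ allFin n ] ∑[ S ∈ allSubsets n ] (dom S * w S v) ∎

    sumA≡ : sumA G ≡ ∑ (allFin n) critical
    sumA≡ = trans (∑-cong (domSets G) (λ S → length-filter _ (allFin n))) (∑-dominating _)

    size-bound : ∀ (S : Subset n) → ∣ S ∣ < suc n
    size-bound S = s≤s (∣p∣≤n S)

    D'≡ : D'-at-1 G ≡ ∑ (allFin n) containing
    D'≡ = begin
      D'-at-1 G                                        ≡⟨ ∑-by-size ∣_∣ (suc n) size-bound id (domSets G) ⟩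
      ∑[ S ∈ domSets G ] ∣ S ∣                          ≡⟨ ∑-cong (domSets G) ∣∣-as-∑ ⟩
      ∑[ S ∈ domSets G ] ∑[ v ∈ allFin n ] 𝟙 (v ∈? S)  ≡⟨ ∑-dominating (λ S v → 𝟙 (v ∈? S)) ⟩
      ∑ (allFin n) containing                          ∎

    D≡ : D-at-1 G ≡ #dominating
    D≡ = begin
      D-at-1 G                                         ≡⟨ ∑-cong (upTo (suc n)) (λ k → sym (*-identityˡ (d G k))) ⟩
      ∑[ k ∈ upTo (suc n) ] (1 * d G k)                ≡⟨ ∑-by-size ∣_∣ (suc n) size-bound (const 1) (domSets G) ⟩
      ∑[ _ ∈ domSets G ] 1                             ≡⟨ ∑-filter (dominating? G) (allSubsets n) _ ⟩
      ∑[ S ∈ allSubsets n ] (dom S * 1)                ≡⟨ ∑-cong (allSubsets n) (λ S → *-identityʳ (dom S)) ⟩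
      #dominating                                      ∎

    sumA+nD≡2D' : sumA G + n * D-at-1 G ≡ 2 * D'-at-1 G
    sumA+nD≡2D' = begin
      sumA G + n * D-at-1 G                          ≡⟨ cong₂ (λ x y → x + n * y) sumA≡ D≡ ⟩
      ∑ (allFin n) critical + n * #dominating        ≡⟨ double-counting ⟩
      2 * ∑ (allFin n) containing                    ≡⟨ cong (2 *_) (sym D'≡) ⟩
      2 * D'-at-1 G                                  ∎

open import Data.Nat using (ℕ)
open import Data.Integer using (ℤ; +_; _-_; _*_; _⊖_)
import Data.Nat as ℕ
open import Data.Nat.Properties using (m≤n+m; m+n∸n≡m)
open import Data.Integer.Properties using (pos-*; [+m]-[+n]≡m⊖n; ⊖-≥)
open Counting using (sumA+nD≡2D')

ℤ-difference : ∀ {a b c} → a ℕ.+ b ≡ c → + a ≡ + c - + b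
ℤ-difference {a} {b} refl = sym (begin
  + (a ℕ.+ b) - + b     ≡⟨ [+m]-[+n]≡m⊖n (a ℕ.+ b) b ⟩
  (a ℕ.+ b) ⊖ b         ≡⟨ ⊖-≥ (m≤n+m b a) ⟩
  + (a ℕ.+ b ℕ.∸ b)     ≡⟨ cong +_ (m+n∸n≡m a b) ⟩
  + a                   ∎)
  where open ≡-Reasoning

lemma3p1 : (n : ℕ) (G : Graph n) →
    + sumA G ≡ (+ 2) * (+ D'-at-1 G) - (+ n) * (+ D-at-1 G)
lemma3p1 n G =
  trans (ℤ-difference (sumA+nD≡2D' G)) (cong₂ _-_ (pos-* 2 (D'-at-1 G)) (pos-* n (D-at-1 G)))
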